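{- Let $G$ be a finite simple triangle-free graph without isolated vertices. Then $G$ is strongly equistarable if and only if $\overline{L(G)}$ is strongly equistable.
   Context: For a graph $G$, $\mathcal{S}^*(G)$ is the set of maximal stars of $G$ (a star is the set $E(v)$ of all edges incident with a vertex $v$; maximal means not properly contained in another star), and $\mathcal{T}^*(G)$ is the set of all other nonempty subsets of $E(G)$. A graph $G=(V,E)$ without isolated vertices is strongly equistarable if for each $T\in\mathcal{T}^*(G)$ and each real $\gamma\le 1$ there is $\varphi:E\to\mathbb{R}_{>0}$ with $\sum_{e\in S}\varphi(e)=1$ for all $S\in\mathcal{S}^*(G)$ and $\sum_{e\in T}\varphi(e)\ne\gamma$. For a graph $H$, $\mathcal{S}(H)$ is the set of maximal stable sets and $\mathcal{T}(H)$ the set of all other nonempty subsets of $V(H)$; $H$ is strongly equistable if for each $T\in\mathcal{T}(H)$ and each $\gamma\le 1$ there is $\varphi:V(H)\to\mathbb{R}_{>0}$ with $\varphi(S)=1$ for all $S\in\mathcal{S}(H)$ and $\varphi(T)\neq\gamma$ (where $\varphi(X)=\sum_{x\in X}\varphi(x)$). $L(G)$ is the line graph of $G$ and $\overline{H}$ the complement of $H$.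
   Formalization: The weights φ and the parameter γ in the definitions of strongly equistarable and strongly equistable take values in ℚ instead of ℝ. -}

module Defs where

open import Data.Nat using (ℕ)
open import Data.Fin using (Fin)
open import Data.Fin.Properties using (_≟_; _<?_)
open import Data.Bool using (Bool; true; false; _∧_; _∨_; not; if_then_else_)
open import Data.List using (List; foldr; filterᵇ; cartesianProduct; allFin)
open import Data.List.Membership.Propositional using (_∈_)
open import Data.Product using (Σ; ∃; _×_; _,_)
open import Data.Empty using (⊥)
open import Relation.Nullary using (¬_; Dec; does)
open import Relation.Binary.Definitions using (DecidableEquality)
open import Relation.Binary.PropositionalEquality using (_≡_)
open import Data.Product.Properties using (≡-dec)
open import Data.Rational as ℚ using (ℚ; 0ℚ; 1ℚ)

-- Finite graphs given by an explicit duplicate-free vertex list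
-- (vertex sets are subsets of V restricted to the list `vs`,
--  represented by Boolean predicates V → Bool).

record FGraph : Set₁ where
  field
    V   : Set
    eq? : DecidableEquality V
    vs  : List V
    adj : V → V → Bool

module _ (H : FGraph) where
  open FGraph H

  wsum : (V → ℚ) → (V → Bool) → ℚ
  wsum φ X = foldr (λ v acc → if X v then φ v ℚ.+ acc else acc) 0ℚ vs

  _⊆ᵥ_ : (V → Bool) → (V → Bool) → Set
  X ⊆ᵥ Y = ∀ v → v ∈ vs → X v ≡ true → Y v ≡ true

  SameSet : (V → Bool) → (V → Bool) → Set
  SameSet X Y = ∀ v → v ∈ vs → X v ≡ Y v

  NonemptySet : (V → Bool) → Set
  NonemptySet X = ∃ λ v → v ∈ vs × X v ≡ true

  Stable : (V → Bool) → Set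
  Stable X = ∀ u v → u ∈ vs → v ∈ vs → X u ≡ true → X v ≡ true → adj u v ≡ false

  MaxStable : (V → Bool) → Set
  MaxStable X = Stable X × (∀ Y → Stable Y → X ⊆ᵥ Y → SameSet X Y)

  StronglyEquistable : Set
  StronglyEquistable =
    ∀ (T : V → Bool) → NonemptySet T → ¬ MaxStable T →
    ∀ (γ : ℚ) → γ ℚ.≤ 1ℚ →
    Σ (V → ℚ) λ φ →
      (∀ v → v ∈ vs → 0ℚ ℚ.< φ v) ×
      (∀ S → MaxStable S → wsum φ S ≡ 1ℚ) ×
      ¬ (wsum φ T ≡ γ)

complement : FGraph → FGraph
complement H = record
  { V = V ; eq? = eq? ; vs = vs
  ; adj = λ u v → not (does (eq? u v)) ∧ not (adj u v) }
  where open FGraph H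

record SimpleGraph (n : ℕ) : Set where
  field
    adj    : Fin n → Fin n → Bool
    sym    : ∀ u v → adj u v ≡ adj v u
    irrefl : ∀ v → adj v v ≡ false

Edge : ℕ → Set
Edge n = Fin n × Fin n

_==_ : ∀ {n} → Fin n → Fin n → Bool
a == b = does (a ≟ b)

module _ {n : ℕ} (G : SimpleGraph n) where
  open SimpleGraph G

  -- E(G): each edge uv listed once, as the pair (u , v) with u < v
  edges : List (Edge n)
  edges = filterᵇ (λ { (u , v) → does (u <? v) ∧ adj u v })
                  (cartesianProduct (allFin n) (allFin n))

  TriangleFree : Set
  TriangleFree = ∀ u v w → adj u v ≡ true → adj v w ≡ true → adj u w ≡ true → ⊥

  NoIsolated : Set
  NoIsolated = ∀ v → ∃ λ u → adj v u ≡ true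

  lineGraph : FGraph
  lineGraph = record
    { V = Edge n ; eq? = ≡-dec _≟_ _≟_ ; vs = edges
    ; adj = λ { (a , b) (c , d) →
                 not ((a == c) ∧ (b == d)) ∧
                 ((a == c) ∨ (a == d) ∨ (b == c) ∨ (b == d)) } }

  star : Fin n → Edge n → Bool
  star v (a , b) = (v == a) ∨ (v == b)

  IsStar : (Edge n → Bool) → Set
  IsStar X = ∃ λ v → SameSet lineGraph X (star v)

  MaxStar : (Edge n → Bool) → Set
  MaxStar X = IsStar X × (∀ Y → IsStar Y → _⊆ᵥ_ lineGraph X Y → SameSet lineGraph X Y)

  StronglyEquistarable : Set
  StronglyEquistarable =
    ∀ (T : Edge n → Bool) → NonemptySet lineGraph T → ¬ MaxStar T →
    ∀ (γ : ℚ) → γ ℚ.≤ 1ℚ →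
    Σ (Edge n → ℚ) λ φ →
      (∀ e → e ∈ edges → 0ℚ ℚ.< φ e) ×
      (∀ S → MaxStar S → wsum lineGraph φ S ≡ 1ℚ) ×
      ¬ (wsum lineGraph φ T ≡ γ)

{-# OPTIONS --safe #-}
module Submission where

open import Defs
open import Data.Nat using (ℕ)
open import Function using (_∘_)
open import Function.Bundles using (_⇔_; mk⇔; Equivalence)
open import Function.Properties.Equivalence using () renaming (sym to ⇔-sym)
open import Data.Fin using (Fin; _<_)
open import Data.Fin.Properties using (_≟_; _<?_; <-cmp)
open import Data.Bool using (Bool; true; false; _∧_; _∨_; not)
open import Data.Bool.Properties using (⇔→≡; T-≡; T-∧; not-injective) renaming (_≟_ to _≟ᵇ_)
open import Data.List using (allFin; cartesianProduct)
open import Data.List.Relation.Unary.Any using (any?)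
open import Data.List.Membership.Propositional using (_∈_; find; lose)
open import Data.List.Membership.Propositional.Properties
  using (∈-filter⁺; ∈-filter⁻; ∈-cartesianProduct⁺; ∈-allFin)
open import Data.Product using (Σ; ∃; _×_; _,_; proj₁; proj₂)
open import Data.Product.Properties using (≡-dec)
open import Data.Sum using (_⊎_; inj₁; inj₂)
open import Data.Rational as ℚ using (ℚ; 0ℚ; 1ℚ)
open import Relation.Nullary using (¬_; Dec; yes; no; does; contradiction)
open import Relation.Nullary.Decidable using (dec-true; map′; ¬?; _⊎-dec_; _×-dec_; decidable-stable)
open import Relation.Binary using (tri<; tri≈; tri>)
open import Relation.Binary.PropositionalEquality using (_≡_; _≢_; refl; sym; trans; cong)

open Equivalence using (to; from)

-- Maximal stable sets of the complement of L(G) are the maximal families of pairwise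
-- intersecting edges.  In a triangle-free graph every nonempty such family lies in a star:
-- if it contains ab and also an edge avoiding a, that edge contains b, and an edge of the
-- family avoiding b would contain a and meet the former edge at some r, making abr a
-- triangle.  Without isolated vertices stars are nonempty intersecting families, so the
-- maximal ones among both kinds of families coincide.  Strong equistarability of G and
-- strong equistability of the complement of L(G) then quantify over the same weightings
-- of E(G) with the same family of sets of weight 1.

module _ (H : FGraph) where
  open FGraph H

  private
    _⊆_ _≈_ : (V → Bool) → (V → Bool) → Set
    _⊆_ = _⊆ᵥ_ H
    _≈_ = SameSet H

  ⊆-trans : ∀ {X Y Z} → X ⊆ Y → Y ⊆ Z → X ⊆ Z
  ⊆-trans X⊆Y Y⊆Z v v∈ Xv = Y⊆Z v v∈ (X⊆Y v v∈ Xv)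

  ⊆-antisym : ∀ {X Y} → X ⊆ Y → Y ⊆ X → X ≈ Y
  ⊆-antisym X⊆Y Y⊆X v v∈ = ⇔→≡ (mk⇔ (X⊆Y v v∈) (Y⊆X v v∈))

  ≈⇒⊆ : ∀ {X Y} → X ≈ Y → X ⊆ Y
  ≈⇒⊆ X≈Y v v∈ Xv = trans (sym (X≈Y v v∈)) Xv

  ≈⇒⊇ : ∀ {X Y} → X ≈ Y → Y ⊆ X
  ≈⇒⊇ X≈Y v v∈ Yv = trans (X≈Y v v∈) Yv

  ≈-trans : ∀ {X Y Z} → X ≈ Y → Y ≈ Z → X ≈ Z
  ≈-trans X≈Y Y≈Z v v∈ = trans (X≈Y v v∈) (Y≈Z v v∈)

  ⊆-nonempty : ∀ {X Y} → X ⊆ Y → NonemptySet H X → NonemptySet H Y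
  ⊆-nonempty X⊆Y (v , v∈ , Xv) = v , v∈ , X⊆Y v v∈ Xv

  Maximal : ((V → Bool) → Set) → (V → Bool) → Set
  Maximal P X = P X × (∀ Y → P Y → X ⊆ Y → X ≈ Y)

  maximal-nonempty : ∀ {P X Y} → P Y → NonemptySet H Y → Maximal P X → NonemptySet H X
  maximal-nonempty {X = X} {Y} PY (v , v∈ , Yv) (_ , maximal) with any? (λ u → X u ≟ᵇ true) vs
  ... | yes X-meets-vs = find X-meets-vs
  ... | no X-misses-vs = v , v∈ , trans (maximal Y PY X⊆Y v v∈) Yv
    where
    X⊆Y : X ⊆ Y
    X⊆Y u u∈ Xu = contradiction (lose u∈ Xu) X-misses-vs

  maximal-⇔-cofinal :
    ∀ {P Q Y₀} →
    (∀ {X} → Q X → P X) →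
    (∀ {X Y} → X ≈ Y → Q Y → Q X) →
    (∀ {X} → Q X → NonemptySet H X) →
    (∀ {X} → P X → NonemptySet H X → ∃ λ Y → Q Y × X ⊆ Y) →
    Q Y₀ → ∀ X → Maximal Q X ⇔ Maximal P X
  maximal-⇔-cofinal {P} {Q} Q⇒P Q-resp Q-nonempty cofinal QY₀ X = mk⇔ maxQ⇒maxP maxP⇒maxQ
    where
    maxQ⇒maxP : Maximal Q X → Maximal P X
    maxQ⇒maxP (QX , maximal) = Q⇒P QX , λ Y PY X⊆Y →
      let Z , QZ , Y⊆Z = cofinal PY (⊆-nonempty X⊆Y (Q-nonempty QX))
      in ⊆-antisym X⊆Y (⊆-trans Y⊆Z (≈⇒⊇ (maximal Z QZ (⊆-trans X⊆Y Y⊆Z))))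

    maxP⇒maxQ : Maximal P X → Maximal Q X
    maxP⇒maxQ maxP@(PX , maximal) =
      let Z , QZ , X⊆Z = cofinal PX (maximal-nonempty (Q⇒P QY₀) (Q-nonempty QY₀) maxP)
      in Q-resp (maximal Z (Q⇒P QZ) X⊆Z) QZ , λ Y QY → maximal Y (Q⇒P QY)

  -- StronglyEquistable H is definitionally this notion for M = MaxStable H, and
  -- StronglyEquistarable G for H = lineGraph G and M = MaxStar G.  Complementation keeps
  -- the vertex list, so lineGraph G and its complement share weights and weighted sums.
  StronglyEquistableFor : ((V → Bool) → Set) → Set
  StronglyEquistableFor M =
    ∀ (T : V → Bool) → NonemptySet H T → ¬ M T →
    ∀ (γ : ℚ) → γ ℚ.≤ 1ℚ →
    Σ (V → ℚ) λ φ →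
      (∀ v → v ∈ vs → 0ℚ ℚ.< φ v) ×
      (∀ S → M S → wsum H φ S ≡ 1ℚ) ×
      ¬ (wsum H φ T ≡ γ)

  StronglyEquistableFor-resp :
    ∀ {M M′} → (∀ {v} → v ∈ vs → ∀ X → M X ⇔ M′ X) →
    StronglyEquistableFor M → StronglyEquistableFor M′
  StronglyEquistableFor-resp M⇔M′ equi T T≠∅@(_ , v∈ , _) ¬M′T γ γ≤1 =
    let φ , positive , M-weight , T-weight = equi T T≠∅ (¬M′T ∘ to (M⇔M′ v∈ T)) γ γ≤1
    in φ , positive , (λ S M′S → M-weight S (from (M⇔M′ v∈ S) M′S)) , T-weight

does≡true⇔ : ∀ {a} {A : Set a} (a? : Dec A) → does a? ≡ true ⇔ A
does≡true⇔ (yes a) = mk⇔ (λ _ → a) (λ _ → refl)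
does≡true⇔ (no ¬a) = mk⇔ (λ ()) (λ a → contradiction a ¬a)

module _ {n : ℕ} where

  _∈ₑ_ : Fin n → Edge n → Set
  v ∈ₑ (a , b) = v ≡ a ⊎ v ≡ b

  _∈ₑ?_ : ∀ v e → Dec (v ∈ₑ e)
  v ∈ₑ? (a , b) = v ≟ a ⊎-dec v ≟ b

  Meet : Edge n → Edge n → Set
  Meet e f = ∃ λ v → v ∈ₑ e × v ∈ₑ f

  meet? : ∀ e f → Dec (Meet e f)
  meet? (a , b) f = map′ endpoint⇒meet meet⇒endpoint (a ∈ₑ? f ⊎-dec b ∈ₑ? f)
    where
    endpoint⇒meet : a ∈ₑ f ⊎ b ∈ₑ f → Meet (a , b) f
    endpoint⇒meet (inj₁ a∈f) = a , inj₁ refl , a∈f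
    endpoint⇒meet (inj₂ b∈f) = b , inj₂ refl , b∈f

    meet⇒endpoint : Meet (a , b) f → a ∈ₑ f ⊎ b ∈ₑ f
    meet⇒endpoint (_ , inj₁ refl , a∈f) = inj₁ a∈f
    meet⇒endpoint (_ , inj₂ refl , b∈f) = inj₂ b∈f

  meet⇒∈ʳ : ∀ {a b f} → Meet (a , b) f → ¬ a ∈ₑ f → b ∈ₑ f
  meet⇒∈ʳ (_ , inj₁ refl , a∈f) a∉f = contradiction a∈f a∉f
  meet⇒∈ʳ (_ , inj₂ refl , b∈f) _ = b∈f

  meet⇒∈ˡ : ∀ {a b f} → Meet (a , b) f → ¬ b ∈ₑ f → a ∈ₑ f
  meet⇒∈ˡ (_ , inj₁ refl , a∈f) _ = a∈f
  meet⇒∈ˡ (_ , inj₂ refl , b∈f) b∉f = contradiction b∈f b∉f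

  does-≡-dec-pair : (a b c d : Fin n) → does (≡-dec _≟_ _≟_ (a , b) (c , d)) ≡ (a == c) ∧ (b == d)
  does-≡-dec-pair a b c d with a ≟ c
  ... | yes refl = refl
  ... | no _ = refl

-- Adjacency of (a , b) and (c , d) in the complement of L(G), where x, q, r, s test
-- a = c, a = d, b = c, b = d.  The equality test x ∧ s is absorbed: equal edges meet.
complement-lineGraph-adj : ∀ x q r s →
  not (x ∧ s) ∧ not (not (x ∧ s) ∧ (x ∨ q ∨ r ∨ s)) ≡ not ((x ∨ q) ∨ (r ∨ s))
complement-lineGraph-adj true q r true = refl
complement-lineGraph-adj true q r false = refl
complement-lineGraph-adj false q r s = refl

module _ {n : ℕ} (G : SimpleGraph n) where
  open SimpleGraph G renaming (sym to adj-sym)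

  private
    L L̄ : FGraph
    L = lineGraph G
    L̄ = complement L

    _⊆_ : (Edge n → Bool) → (Edge n → Bool) → Set
    _⊆_ = _⊆ᵥ_ L

  ∈-edges⁺ : ∀ {a b} → a < b → adj a b ≡ true → (a , b) ∈ edges G
  ∈-edges⁺ {a} {b} a<b ab =
    ∈-filter⁺ _ (∈-cartesianProduct⁺ (∈-allFin a) (∈-allFin b))
      (from T-∧ (from T-≡ (dec-true (a <? b) a<b) , from T-≡ ab))

  ∈-edges⇒adj : ∀ {a b} → (a , b) ∈ edges G → adj a b ≡ true
  ∈-edges⇒adj {a} {b} ab∈ =
    to T-≡ (proj₂ (to T-∧ (proj₂ (∈-filter⁻ _ {xs = cartesianProduct (allFin n) (allFin n)} ab∈))))

  endpoints-adjacent : ∀ {e u v} → e ∈ edges G → u ∈ₑ e → v ∈ₑ e → u ≢ v → adj u v ≡ true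
  endpoints-adjacent e∈ (inj₁ refl) (inj₂ refl) _ = ∈-edges⇒adj e∈
  endpoints-adjacent {a , b} e∈ (inj₂ refl) (inj₁ refl) _ = trans (adj-sym b a) (∈-edges⇒adj e∈)
  endpoints-adjacent _ (inj₁ refl) (inj₁ refl) u≢v = contradiction refl u≢v
  endpoints-adjacent _ (inj₂ refl) (inj₂ refl) u≢v = contradiction refl u≢v

  incident-edge : ∀ {v w} → adj v w ≡ true → ∃ λ e → e ∈ edges G × v ∈ₑ e
  incident-edge {v} {w} vw with <-cmp v w
  ... | tri< v<w _ _ = (v , w) , ∈-edges⁺ v<w vw , inj₁ refl
  ... | tri≈ _ refl _ with () ← trans (sym (irrefl v)) vw
  ... | tri> _ _ w<v = (w , v) , ∈-edges⁺ w<v (trans (adj-sym w v) vw) , inj₂ refl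

  star≡true⇔ : ∀ v e → star G v e ≡ true ⇔ v ∈ₑ e
  star≡true⇔ v (a , b) = does≡true⇔ (v ∈ₑ? (a , b))

  complement-adj≡not-meet : ∀ e f → FGraph.adj L̄ e f ≡ not (does (meet? e f))
  complement-adj≡not-meet (a , b) (c , d) =
    trans (cong (λ δ → not δ ∧ not (not ((a == c) ∧ (b == d)) ∧ ((a == c) ∨ (a == d) ∨ (b == c) ∨ (b == d))))
                (does-≡-dec-pair a b c d))
          (complement-lineGraph-adj (a == c) (a == d) (b == c) (b == d))

  complement-adj≡false⇔meet : ∀ e f → FGraph.adj L̄ e f ≡ false ⇔ Meet e f
  complement-adj≡false⇔meet e f rewrite complement-adj≡not-meet e f =
    mk⇔ (to (does≡true⇔ (meet? e f)) ∘ not-injective) (cong not ∘ from (does≡true⇔ (meet? e f)))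

  Intersecting : (Edge n → Bool) → Set
  Intersecting X = ∀ e f → e ∈ edges G → f ∈ edges G → X e ≡ true → X f ≡ true → Meet e f

  stable⇔intersecting : ∀ X → Stable L̄ X ⇔ Intersecting X
  stable⇔intersecting X = mk⇔
    (λ stable e f e∈ f∈ Xe Xf → to (complement-adj≡false⇔meet e f) (stable e f e∈ f∈ Xe Xf))
    (λ meet e f e∈ f∈ Xe Xf → from (complement-adj≡false⇔meet e f) (meet e f e∈ f∈ Xe Xf))

  ⊆-star⇒intersecting : ∀ {X} v → X ⊆ star G v → Intersecting X
  ⊆-star⇒intersecting v X⊆Ev e f e∈ f∈ Xe Xf =
    v , to (star≡true⇔ v e) (X⊆Ev e e∈ Xe) , to (star≡true⇔ v f) (X⊆Ev f f∈ Xf)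

  intersecting⇒⊆-star : TriangleFree G → ∀ {X} → Intersecting X → NonemptySet L X →
                        ∃ λ w → X ⊆ star G w
  intersecting⇒⊆-star triangle-free {X} meet ((a , b) , ab∈ , Xab)
    with any? (λ f → (X f ≟ᵇ true) ×-dec ¬? (a ∈ₑ? f)) (edges G)
  ... | no ∄f = a , λ g g∈ Xg →
    from (star≡true⇔ a g) (decidable-stable (a ∈ₑ? g) (λ a∉g → ∄f (lose g∈ (Xg , a∉g))))
  ... | yes ∃f with find ∃f
  ...   | f , f∈ , Xf , a∉f = b , λ g g∈ Xg → from (star≡true⇔ b g) (b∈ g g∈ Xg)
    where
    b∈f : b ∈ₑ f
    b∈f = meet⇒∈ʳ (meet (a , b) f ab∈ f∈ Xab Xf) a∉f

    b∈ : ∀ g → g ∈ edges G → X g ≡ true → b ∈ₑ g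
    b∈ g g∈ Xg with b ∈ₑ? g
    ... | yes b∈g = b∈g
    ... | no b∉g = contradiction
          (endpoints-adjacent f∈ b∈f r∈f λ { refl → b∉g r∈g })
          (λ br → triangle-free a b r (∈-edges⇒adj ab∈) br
                    (endpoints-adjacent g∈ a∈g r∈g λ { refl → a∉f r∈f }))
      where
      a∈g : a ∈ₑ g
      a∈g = meet⇒∈ˡ (meet (a , b) g ab∈ g∈ Xab Xg) b∉g
      r = proj₁ (meet f g f∈ g∈ Xf Xg)
      r∈f = proj₁ (proj₂ (meet f g f∈ g∈ Xf Xg))
      r∈g = proj₂ (proj₂ (meet f g f∈ g∈ Xf Xg))

  isStar⇒stable : ∀ {X} → IsStar G X → Stable L̄ X
  isStar⇒stable {X} (w , X≈Ew) = from (stable⇔intersecting X) (⊆-star⇒intersecting w (≈⇒⊆ L X≈Ew))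

  isStar-resp : ∀ {X Y} → SameSet L X Y → IsStar G Y → IsStar G X
  isStar-resp X≈Y (w , Y≈Ew) = w , ≈-trans L X≈Y Y≈Ew

  isStar-nonempty : NoIsolated G → ∀ {X} → IsStar G X → NonemptySet L X
  isStar-nonempty no-isolated (v , X≈Ev) =
    let w , vw = no-isolated v
        e , e∈ , v∈e = incident-edge vw
    in ⊆-nonempty L (≈⇒⊇ L X≈Ev) (e , e∈ , from (star≡true⇔ v e) v∈e)

  stable⇒⊆-star : TriangleFree G → ∀ {X} → Stable L̄ X → NonemptySet L X →
                  ∃ λ Y → IsStar G Y × X ⊆ Y
  stable⇒⊆-star triangle-free {X} stable X≠∅ =
    let w , X⊆Ew = intersecting⇒⊆-star triangle-free (to (stable⇔intersecting X) stable) X≠∅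
    in star G w , (w , λ _ _ → refl) , X⊆Ew

  maxStar⇔maxStable : TriangleFree G → NoIsolated G → Fin n →
                      ∀ X → MaxStar G X ⇔ MaxStable L̄ X
  maxStar⇔maxStable triangle-free no-isolated v =
    maximal-⇔-cofinal L isStar⇒stable isStar-resp (isStar-nonempty no-isolated)
      (stable⇒⊆-star triangle-free) (v , λ _ _ → refl)

lemma10 : (n : ℕ) (G : SimpleGraph n) → TriangleFree G → NoIsolated G →
    StronglyEquistarable G ⇔ StronglyEquistable (complement (lineGraph G))
lemma10 _ G triangle-free no-isolated =
  mk⇔ (StronglyEquistableFor-resp (lineGraph G) maxima-agree)
      (StronglyEquistableFor-resp (lineGraph G) (λ e∈ X → ⇔-sym (maxima-agree e∈ X)))
  where
  maxima-agree : ∀ {e} → e ∈ edges G → ∀ X → MaxStar G X ⇔ MaxStable (complement (lineGraph G)) X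
  maxima-agree {a , _} _ = maxStar⇔maxStable G triangle-free no-isolated a
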